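{- Let $G$ be a bispanning graph and $(S,T)$ an ordered pair of disjoint spanning trees with $S\cup T=E(G)$. For $(e,f)\in S\times T$: $D_G(S,e)\cap C_G(T,e)=\{e,f\}$ holds if and only if, setting $S'=S-e+f$ and $T'=T+e-f$, we have $D_G(S',f)\cap C_G(T',f)=\{f,e\}$ (i.e. $(f,e)\in S'\times T'$ is a unique $S'$ edge exchange leading back to $(S,T)$). Likewise, for $(f,e)\in T\times S$: $D_G(T,f)\cap C_G(S,f)=\{f,e\}$ if and only if, with $S''=S+f-e$ and $T''=T-f+e$, $D_G(T'',e)\cap C_G(S'',e)=\{e,f\}$.
   Context: Graphs are finite, undirected, possibly with parallel edges, no loops. A graph is bispanning if its edge set is the disjoint union of two spanning trees. For a spanning tree $T$ and an edge $e\notin T$, $C_G(T,e)$ denotes the unique cycle (edge set) in $T+e$. For a spanning tree $S$ and $e\in S$, $D_G(S,e)$ denotes the set of edges of $G$ joining the two components of $S-e$ (including $e$). If $(e,f)\in S\times T$ and $D_G(S,e)\cap C_G(T,e)=\{e,f\}$, then $S-e+f$ and $T+e-f$ are disjoint spanning trees; such an $(e,f)$ is called a unique $S$ edge exchange. -}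

module Defs where

open import Data.Nat using (ℕ)
open import Data.Fin using (Fin)
open import Data.Fin.Subset using (Subset; _∈_; _∉_; _∪_; _-_; ⁅_⁆)
open import Data.List using (List; []; _∷_)
open import Data.List.Relation.Unary.Unique.Propositional using (Unique)
import Data.List.Membership.Propositional as LMem
open import Data.Product using (Σ; ∃; _×_; _,_)
open import Data.Sum using (_⊎_)
open import Data.Empty using (⊥)
open import Relation.Nullary using (¬_)
open import Relation.Binary.PropositionalEquality using (_≡_; _≢_)
open import Function.Bundles using (_⇔_)

record Multigraph (n m : ℕ) : Set where
  field
    src      : Fin m → Fin n
    tgt      : Fin m → Fin n
    loopless : ∀ e → src e ≢ tgt e

module _ {n m : ℕ} (G : Multigraph n m) where
  open Multigraph G

  Joins : Fin m → Fin n → Fin n → Set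
  Joins e u v = (src e ≡ u × tgt e ≡ v) ⊎ (src e ≡ v × tgt e ≡ u)

  -- Walk X u v es vs : a walk from u to v using only edges of the edge set X,
  -- traversing the edges es in order, and visiting the vertices vs after u.
  data Walk (X : Subset m) : Fin n → Fin n → List (Fin m) → List (Fin n) → Set where
    stop : ∀ {u} → Walk X u u [] []
    step : ∀ {u w v e es vs} → e ∈ X → Joins e u w →
           Walk X w v es vs → Walk X u v (e ∷ es) (w ∷ vs)

  Reach : Subset m → Fin n → Fin n → Set
  Reach X u v = Σ (List (Fin m)) λ es → Σ (List (Fin n)) λ vs → Walk X u v es vs

  Connected : Subset m → Set
  Connected X = ∀ u v → Reach X u v

  -- A cycle in (V(G), X): a nonempty closed walk with pairwise distinct edges
  -- and pairwise distinct vertices (the start vertex occurs once, at the end of vs).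
  IsCycle : Subset m → Fin n → List (Fin m) → List (Fin n) → Set
  IsCycle X u es vs = Walk X u u es vs × (es ≢ []) × Unique es × Unique vs

  Acyclic : Subset m → Set
  Acyclic X = ∀ u es vs → ¬ IsCycle X u es vs

  SpanningTree : Subset m → Set
  SpanningTree X = Connected X × Acyclic X

  -- g ∈ C_G(T,e): g lies on a cycle of T + e (for e ∉ T this cycle is unique).
  InC : Subset m → Fin m → Fin m → Set
  InC T e g = ∃ λ u → ∃ λ es → ∃ λ vs → IsCycle (T ∪ ⁅ e ⁆) u es vs × LMem._∈_ g es

  -- g ∈ D_G(S,e): g joins the two components of S - e, i.e. its endpoints
  -- are not connected in S - e.
  InD : Subset m → Fin m → Fin m → Set
  InD S e g = ¬ Reach (S - e) (src g) (tgt g)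

  DCPair : Subset m → Subset m → Fin m → Fin m → Fin m → Set
  DCPair S T e a b = ∀ g → ((InD S e g × InC T e g) ⇔ (g ≡ a ⊎ g ≡ b))

  BispanningPair : Subset m → Subset m → Set
  BispanningPair S T =
    SpanningTree S × SpanningTree T × (∀ g → g ∈ S → g ∉ T) × (∀ g → g ∈ S ⊎ g ∈ T)

-- Exchanging e ∈ S for f ∈ T leaves unchanged the two sets the exchange condition
-- depends on: as f ∉ S, the forest S' - f is S - e, and as f ∈ T, the graph T' + f
-- is T + e.  Hence D(S',f) = D(S,e) and C(T',f) = C(T,e), so both sides of the
-- equivalence say D(S,e) ∩ C(T,e) = {e,f}.
module Submission where

open import Defs
open import Data.Nat using (ℕ)
open import Data.Fin using (Fin; _≟_)
open import Data.Fin.Subset using (Subset; _∈_; _∉_; _∪_; _-_; _─_; ⁅_⁆; outside; inside)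
open import Data.Fin.Subset.Properties
  using (⊆-antisym; x∈p∪q⁻; x∈p∪q⁺; x∈⁅x⁆; x∈⁅y⁆⇒x≡y; x∈p∧x≢y⇒x∈p-y; p─q⊆p)
import Data.List.Membership.Propositional as List
open import Data.Product using (∃; _×_; _,_)
open import Data.Sum using (_⊎_; inj₁; inj₂; [_,_]; swap)
open import Function using (_∘_)
open import Data.Vec using (_∷_; there)
open import Function.Bundles using (_⇔_; mk⇔; Equivalence)
open import Relation.Nullary using (¬_; yes; no; contradiction)
open import Relation.Binary.PropositionalEquality
  using (_≡_; _≢_; refl; sym; cong; cong₂; subst)

private
  variable
    k : ℕ
    p q : Subset k
    x y : Fin k

x∈p─q⇒x∉q : x ∈ p ─ q → x ∉ q
x∈p─q⇒x∉q {p = _ ∷ p} {outside ∷ q} (there x∈p─q) (there x∈q) = x∈p─q⇒x∉q {p = p} x∈p─q x∈q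
x∈p─q⇒x∉q {p = _ ∷ p} {inside  ∷ q} (there x∈p─q) (there x∈q) = x∈p─q⇒x∉q {p = p} x∈p─q x∈q

x∈p-y⇒x≢y : x ∈ p - y → x ≢ y
x∈p-y⇒x≢y {p = p} {y = y} x∈p-y refl = x∈p─q⇒x∉q {p = p} x∈p-y (x∈⁅x⁆ y)

p∪⁅y⁆-y≡p : y ∉ p → (p ∪ ⁅ y ⁆) - y ≡ p
p∪⁅y⁆-y≡p {y = y} {p = p} y∉p = ⊆-antisym ⊆p ⊇p
  where
  ⊆p : ∀ {x} → x ∈ (p ∪ ⁅ y ⁆) - y → x ∈ p
  ⊆p x∈ = [ (λ x∈p → x∈p)
           , (λ x∈⁅y⁆ → contradiction (x∈⁅y⁆⇒x≡y y x∈⁅y⁆) (x∈p-y⇒x≢y {p = p ∪ ⁅ y ⁆} x∈))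
           ] (x∈p∪q⁻ p ⁅ y ⁆ (p─q⊆p (p ∪ ⁅ y ⁆) ⁅ y ⁆ x∈))
  ⊇p : ∀ {x} → x ∈ p → x ∈ (p ∪ ⁅ y ⁆) - y
  ⊇p x∈p = x∈p∧x≢y⇒x∈p-y (x∈p∪q⁺ (inj₁ x∈p)) (λ { refl → y∉p x∈p })

p-y∪⁅y⁆≡p : y ∈ p → (p - y) ∪ ⁅ y ⁆ ≡ p
p-y∪⁅y⁆≡p {y = y} {p = p} y∈p = ⊆-antisym ⊆p ⊇p
  where
  ⊆p : ∀ {x} → x ∈ (p - y) ∪ ⁅ y ⁆ → x ∈ p
  ⊆p x∈ = [ p─q⊆p p ⁅ y ⁆ , (λ x∈⁅y⁆ → subst (_∈ p) (sym (x∈⁅y⁆⇒x≡y y x∈⁅y⁆)) y∈p) ]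
            (x∈p∪q⁻ (p - y) ⁅ y ⁆ x∈)
  ⊇p : ∀ {x} → x ∈ p → x ∈ (p - y) ∪ ⁅ y ⁆
  ⊇p {x} x∈p with x ≟ y
  ... | yes refl = x∈p∪q⁺ (inj₂ (x∈⁅x⁆ y))
  ... | no x≢y   = x∈p∪q⁺ (inj₁ (x∈p∧x≢y⇒x∈p-y x∈p x≢y))

module _ {n m : ℕ} (G : Multigraph n m) where

  InD-cong : ∀ {S S′ e e′ g} → S - e ≡ S′ - e′ → InD G S e g ≡ InD G S′ e′ g
  InD-cong {g = g} = cong λ X → ¬ Reach G X (Multigraph.src G g) (Multigraph.tgt G g)

  InC-cong : ∀ {T T′ e e′ g} → T ∪ ⁅ e ⁆ ≡ T′ ∪ ⁅ e′ ⁆ → InC G T e g ≡ InC G T′ e′ g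
  InC-cong {g = g} = cong λ X → ∃ λ u → ∃ λ es → ∃ λ vs → IsCycle G X u es vs × g List.∈ es

  DCPair-transport : ∀ {S T S′ T′ e e′ a b} →
    S - e ≡ S′ - e′ → T ∪ ⁅ e ⁆ ≡ T′ ∪ ⁅ e′ ⁆ →
    DCPair G S T e a b → DCPair G S′ T′ e′ b a
  DCPair-transport {a = a} {b} D≡ C≡ dc g =
    subst (λ P → P ⇔ (g ≡ b ⊎ g ≡ a))
          (cong₂ _×_ (InD-cong D≡) (InC-cong C≡))
          (mk⇔ (swap ∘ Equivalence.to (dc g)) (Equivalence.from (dc g) ∘ swap))

  DCPair-exchange : ∀ {S T e f} → f ∉ S → f ∈ T →
    DCPair G S T e e f ⇔ DCPair G ((S - e) ∪ ⁅ f ⁆) ((T ∪ ⁅ e ⁆) - f) f f e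
  DCPair-exchange {S} {T} {e} {f} f∉S f∈T =
    mk⇔ (DCPair-transport (sym D≡) (sym C≡)) (DCPair-transport D≡ C≡)
    where
    D≡ : ((S - e) ∪ ⁅ f ⁆) - f ≡ S - e
    D≡ = p∪⁅y⁆-y≡p (f∉S ∘ p─q⊆p S ⁅ e ⁆)
    C≡ : ((T ∪ ⁅ e ⁆) - f) ∪ ⁅ f ⁆ ≡ T ∪ ⁅ e ⁆
    C≡ = p-y∪⁅y⁆≡p (x∈p∪q⁺ (inj₁ f∈T))

mainTheorem3 : ∀ {n m : ℕ} (G : Multigraph n m) (S T : Subset m) →
    BispanningPair G S T →
    (∀ (e f : Fin m) → e ∈ S → f ∈ T →
      (DCPair G S T e e f ⇔
       DCPair G ((S - e) ∪ ⁅ f ⁆) ((T ∪ ⁅ e ⁆) - f) f f e))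
    ×
    (∀ (f e : Fin m) → f ∈ T → e ∈ S →
      (DCPair G T S f f e ⇔
       DCPair G ((T - f) ∪ ⁅ e ⁆) ((S ∪ ⁅ f ⁆) - e) e e f))
mainTheorem3 G S T (_ , _ , S∩T≡∅ , _) =
  (λ e f e∈S f∈T → DCPair-exchange G (λ f∈S → S∩T≡∅ f f∈S f∈T) f∈T) ,
  (λ f e f∈T e∈S → DCPair-exchange G (S∩T≡∅ e e∈S) e∈S)
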